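{- Let $\widehat{X}$ be a sink-distance-regular directed graph with parameters $d$, $\{a_i\}_{i=1}^d$, $\{b_i\}_{i=1}^d$, $\{c_i\}_{i=1}^d$. Define $n_{d+1}=0$, $$n_d=\left\lfloor\frac{\deg^{+}(\Gamma_d)-1}{c_d}\right\rfloor,\qquad n_i=\left\lfloor\frac{\deg^{+}(\Gamma_i)-1+n_{i+1}b_i}{c_i}\right\rfloor\ (1\le i<d).$$ Then the identity element of the sandpile group $\mathcal{G}(\widehat{X})$ is the configuration $$e=\sum_{i=1}^d (n_ic_i-n_{i+1}b_i)\,\gamma_i.$$
   Context: Let $\widehat X$ be a finite weakly connected directed multigraph (loops and multiple edges allowed) with a distinguished sink vertex $s$ reachable from all vertices and at least one non-sink vertex. A configuration assigns a nonnegative integer number of grains to each non-sink vertex; it is stable if every $v$ holds fewer than $\deg^{+}(v)$ (out-degree) grains; toppling an unstable vertex sends one grain along each out-edge (grains reaching the sink vanish; the sink never topples); every configuration has a unique stabilization. The sandpile monoid $\mathcal M(\widehat X)$ is the set of stable configurations with $a\oplus b$ = stabilization of $a+b$, and the sandpile group $\mathcal G(\widehat X)$ is its minimal ideal, which is a group. For vertices $x,y$, $\delta(x,y)$ is the length of a shortest directed path from $x$ to $y$; $\Gamma_i=\{x:\delta(x,s)=i\}$ and $d=\max_x\delta(x,s)$. $\widehat X$ is sink-distance-regular if the sink has out-degree $0$, every edge with tail in $\Gamma_i$ has head in $\Gamma_{i-1}\cup\Gamma_i\cup\Gamma_{i+1}$ ($\Gamma_{d+1}=\emptyset$), and there are nonnegative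 integers $a_1,\dots,a_d$ and positive integers $b_1,\dots,b_{d-1}$, $c_1,\dots,c_d$ (with $b_d:=0$) such that: each $v\in\Gamma_1$ is the tail of exactly $c_1$ edges with head the sink; each $v\in\Gamma_i$, $i>1$, is the tail of exactly $c_i$ edges with heads in $\Gamma_{i-1}$ and the head of exactly $c_i$ edges with tails in $\Gamma_{i-1}$; and each $v\in\Gamma_i$, $i\ge1$, is the tail of exactly $a_i$ edges with heads in $\Gamma_i$, the head of exactly $a_i$ edges with tails in $\Gamma_i$, the tail of exactly $b_i$ edges with heads in $\Gamma_{i+1}$, and the head of exactly $b_i$ edges with tails in $\Gamma_{i+1}$. $\deg^{+}(\Gamma_i)=a_i+b_i+c_i$ is the common out-degree of the vertices of $\Gamma_i$ ($i\ge1$). $\gamma_i$ is the configuration with one grain on each vertex of $\Gamma_i$ and none elsewhere. -}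

module Defs where

open import Data.Nat using (ℕ; zero; suc; _+_; _*_; _∸_; _≤_; _<_; _/_)
open import Data.Fin using (Fin; zero; suc; _≟_)
open import Data.Vec using (Vec; lookup; tabulate; zipWith)
open import Data.Product using (Σ; _×_; ∃)
open import Relation.Nullary using (¬_; yes; no)
open import Relation.Binary.PropositionalEquality using (_≡_)
open import Relation.Binary.Construct.Closure.ReflexiveTransitive using (Star)

-- A sandpile graph with n non-sink vertices has vertex set Fin (suc n);
-- the vertex  zero  is the sink s, and  suc j  is the j-th non-sink vertex.
-- A directed multigraph (loops / multiple edges allowed) is given by its
-- edge-multiplicity function  E x y = number of edges with tail x, head y.

Mult : ℕ → Set
Mult n = Fin (suc n) → Fin (suc n) → ℕ

∑ : (m : ℕ) → (Fin m → ℕ) → ℕ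
∑ zero    f = 0
∑ (suc m) f = f zero + ∑ m (λ j → f (suc j))

outdeg : {n : ℕ} → Mult n → Fin (suc n) → ℕ
outdeg {n} E v = ∑ (suc n) (λ w → E v w)

data Walk {n : ℕ} (E : Mult n) : ℕ → Fin (suc n) → Fin (suc n) → Set where
  nil  : ∀ {x} → Walk E 0 x x
  cons : ∀ {k x z y} → 0 < E x z → Walk E k z y → Walk E (suc k) x y

IsDist : {n : ℕ} → Mult n → Fin (suc n) → Fin (suc n) → ℕ → Set
IsDist E x y k = Walk E k x y × (∀ j → j < k → ¬ Walk E j x y)

[_≡ℕ_] : ℕ → ℕ → ℕ
[ zero ≡ℕ zero ] = 1
[ zero ≡ℕ suc j ] = 0
[ suc i ≡ℕ zero ] = 0
[ suc i ≡ℕ suc j ] = [ i ≡ℕ j ]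

-- number of edges with tail v and head in Γ_i  (dist = distance-to-sink function)
outTo : {n : ℕ} → Mult n → (Fin (suc n) → ℕ) → Fin (suc n) → ℕ → ℕ
outTo {n} E dist v i = ∑ (suc n) (λ w → [ dist w ≡ℕ i ] * E v w)

inFrom : {n : ℕ} → Mult n → (Fin (suc n) → ℕ) → Fin (suc n) → ℕ → ℕ
inFrom {n} E dist v i = ∑ (suc n) (λ w → [ dist w ≡ℕ i ] * E w v)

-- Sink-distance-regularity with parameters d, a, b, c (indices 1..d used),
-- where dist is the function x ↦ δ(x,s).
record SinkDistanceRegular {n : ℕ} (E : Mult n) (dist : Fin (suc n) → ℕ)
                           (d : ℕ) (a b c : ℕ → ℕ) : Set where
  field
    dist-is-δ   : ∀ x → IsDist E x zero (dist x)
    d-bound     : ∀ x → dist x ≤ d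
    d-attained  : ∃ λ x → dist x ≡ d
    sink-outdeg : outdeg E zero ≡ 0
    edge-layers : ∀ x y → 0 < E x y → dist y ≤ suc (dist x) × dist x ≤ suc (dist y)
    b-pos       : ∀ i → 1 ≤ i → i < d → 0 < b i
    b-top       : b d ≡ 0
    c-pos       : ∀ i → 1 ≤ i → i ≤ d → 0 < c i
    c-one       : ∀ v → dist v ≡ 1 → outTo E dist v 0 ≡ c 1
    c-out       : ∀ v i → dist v ≡ suc (suc i) → outTo E dist v (suc i) ≡ c (suc (suc i))
    c-in        : ∀ v i → dist v ≡ suc (suc i) → inFrom E dist v (suc i) ≡ c (suc (suc i))
    a-out       : ∀ v i → dist v ≡ suc i → outTo E dist v (suc i) ≡ a (suc i)
    a-in        : ∀ v i → dist v ≡ suc i → inFrom E dist v (suc i) ≡ a (suc i)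
    b-out       : ∀ v i → dist v ≡ suc i → outTo E dist v (suc (suc i)) ≡ b (suc i)
    b-in        : ∀ v i → dist v ≡ suc i → inFrom E dist v (suc (suc i)) ≡ b (suc i)

-- Sandpile dynamics.  Configurations: Vec ℕ n (grains on non-sink vertices).

Config : ℕ → Set
Config n = Vec ℕ n

Stable : {n : ℕ} → Mult n → Config n → Set
Stable E x = ∀ j → lookup x j < outdeg E (suc j)

removed : {n : ℕ} → Mult n → Fin n → Fin n → ℕ
removed E i j with i ≟ j
... | yes _ = outdeg E (suc i)
... | no  _ = 0

data Topple {n : ℕ} (E : Mult n) : Config n → Config n → Set where
  topple : ∀ x i → outdeg E (suc i) ≤ lookup x i →
           Topple E x (tabulate (λ j → (lookup x j + E (suc i) (suc j)) ∸ removed E i j))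

Stab : {n : ℕ} → Mult n → Config n → Config n → Set
Stab E x y = Star (Topple E) x y × Stable E y

_+ᶜ_ : {n : ℕ} → Config n → Config n → Config n
x +ᶜ y = zipWith _+_ x y

IsIdeal : {n : ℕ} → Mult n → (Config n → Set) → Set
IsIdeal E I = (∀ x → I x → Stable E x) ×
              (∀ x y z → I x → Stable E y → Stab E (x +ᶜ y) z → I z)

IsMinimalIdeal : {n : ℕ} → Mult n → (Config n → Set) → Set₁
IsMinimalIdeal {n} E I =
  IsIdeal E I × (∃ λ x → I x) ×
  (∀ (J : Config n → Set) → IsIdeal E J → (∃ λ x → J x) →
     (∀ x → J x → I x) → ∀ x → I x → J x)

-- floor division, with the (unused) convention m / 0 = 0
_div_ : ℕ → ℕ → ℕ
m div zero    = 0
m div (suc k) = m / suc k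

-- deg⁺(Γ_i) = a_i + b_i + c_i
degΓ : (a b c : ℕ → ℕ) → ℕ → ℕ
degΓ a b c i = a i + b i + c i

-- nFromTop d a b c k = n_{d+1-k}   (k = 0 gives n_{d+1} = 0)
nFromTop : (d : ℕ) → (a b c : ℕ → ℕ) → ℕ → ℕ
nFromTop d a b c zero    = 0
nFromTop d a b c (suc k) =
  let i = d ∸ k in
  ((degΓ a b c i ∸ 1) + nFromTop d a b c k * b i) div c i

nSeq : (d : ℕ) → (a b c : ℕ → ℕ) → ℕ → ℕ
nSeq d a b c i = nFromTop d a b c (suc d ∸ i)

eCoef : (d : ℕ) → (a b c : ℕ → ℕ) → ℕ → ℕ
eCoef d a b c i = nSeq d a b c i * c i ∸ nSeq d a b c (suc i) * b i

-- e = Σ_i eCoef_i γ_i : vertex v ∈ Γ_i receives eCoef_i grains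
eConfig : {n : ℕ} → (dist : Fin (suc n) → ℕ) → (d : ℕ) → (a b c : ℕ → ℕ) → Config n
eConfig dist d a b c = tabulate (λ j → eCoef d a b c (dist (suc j)))

-- Toppling is confluent towards stable configurations, so if e + m topples to m for one
-- element m of the minimal ideal G, the elements of G absorbing e form an ideal, which is then
-- all of G. Take m to be the maximal stable configuration; it lies in every ideal.
-- On configurations constant on each layer Γ_i, toppling all of Γ_i moves grains only into
-- Γ_{i-1}, Γ_i and Γ_{i+1}, and firing Γ_k, Γ_{k+1}, …, Γ_d in turn (a cascade at k) takes c_k
-- grains from every vertex of Γ_k and adds b_{k-1} to every vertex of Γ_{k-1}. The coefficients
-- of e are exactly what n_k cascades at every layer k, performed from the top down, remove from
-- e + m to reach m, and the floors defining n_k make every firing legal. Ceilings instead of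
-- floors give a stable f such that m + f topples to e, so e lies in G.

module Submission where

open import Defs
open import Data.Empty using (⊥)
open import Data.Fin using (Fin; zero; suc) renaming (_≟_ to _≟ᶠ_)
open import Data.Fin.Properties using () renaming (suc-injective to Fin-suc-injective)
open import Data.Nat using (ℕ; zero; suc; _+_; _*_; _∸_; _≤_; _<_; _/_; z≤n; s≤s; _≟_)
open import Data.Nat.DivMod using (m≡m%n+[m/n]*n; m%n<n; m/n*n≤m)
open import Data.Nat.Properties
open import Algebra.Properties.CommutativeSemigroup +-commutativeSemigroup
  using (interchange; xy∙z≈xz∙y; x∙yz≈xz∙y)
open import Data.Product using (_×_; _,_; proj₁; proj₂)
open import Data.Sum using (inj₁; inj₂)
open import Data.Vec using (lookup; tabulate)
open import Data.Vec.Properties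
  using (lookup∘tabulate; tabulate∘lookup; tabulate-cong; lookup-zipWith; zipWith-assoc; zipWith-comm)
open import Function using (_∘_; id)
open import Function.Definitions using (Injective)
open import Relation.Binary.Construct.Closure.ReflexiveTransitive using (Star; ε; _◅_; _◅◅_; gmap)
open import Relation.Binary.PropositionalEquality
open import Relation.Nullary using (yes; no; contradiction)

open ≡-Reasoning

vec-ext : ∀ {m} {xs ys : Config m} → (∀ j → lookup xs j ≡ lookup ys j) → xs ≡ ys
vec-ext {xs = xs} {ys} eq = begin
  xs                   ≡⟨ tabulate∘lookup xs ⟨
  tabulate (lookup xs) ≡⟨ tabulate-cong eq ⟩
  tabulate (lookup ys) ≡⟨ tabulate∘lookup ys ⟩
  ys                   ∎

lookup-+ᶜ : ∀ {m} (x y : Config m) j → lookup (x +ᶜ y) j ≡ lookup x j + lookup y j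
lookup-+ᶜ x y j = lookup-zipWith _+_ j x y

+ᶜ-assoc : ∀ {m} (x y z : Config m) → (x +ᶜ y) +ᶜ z ≡ x +ᶜ (y +ᶜ z)
+ᶜ-assoc = zipWith-assoc +-assoc

+ᶜ-comm : ∀ {m} (x y : Config m) → x +ᶜ y ≡ y +ᶜ x
+ᶜ-comm = zipWith-comm +-comm

∑-cong : ∀ m {f g : Fin m → ℕ} → (∀ p → f p ≡ g p) → ∑ m f ≡ ∑ m g
∑-cong zero    f≗g = refl
∑-cong (suc m) f≗g = cong₂ _+_ (f≗g zero) (∑-cong m (f≗g ∘ suc))

∑-distrib-+ : ∀ m (f g : Fin m → ℕ) → ∑ m (λ p → f p + g p) ≡ ∑ m f + ∑ m g
∑-distrib-+ zero    f g = refl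
∑-distrib-+ (suc m) f g = begin
  f zero + g zero + ∑ m (λ p → f (suc p) + g (suc p))
    ≡⟨ cong (f zero + g zero +_) (∑-distrib-+ m (f ∘ suc) (g ∘ suc)) ⟩
  f zero + g zero + (∑ m (f ∘ suc) + ∑ m (g ∘ suc))
    ≡⟨ interchange (f zero) (g zero) _ _ ⟩
  ∑ (suc m) f + ∑ (suc m) g ∎

∑-zero : ∀ m {f : Fin m → ℕ} → (∀ p → f p ≡ 0) → ∑ m f ≡ 0
∑-zero zero    f≗0 = refl
∑-zero (suc m) f≗0 = cong₂ _+_ (f≗0 zero) (∑-zero m (f≗0 ∘ suc))

∑-single : ∀ m (f : Fin m → ℕ) l → (∀ p → p ≢ l → f p ≡ 0) → ∑ m f ≡ f l
∑-single (suc m) f zero    f≗0 =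
  trans (cong (f zero +_) (∑-zero m (λ p → f≗0 (suc p) λ ()))) (+-identityʳ (f zero))
∑-single (suc m) f (suc l) f≗0 =
  cong₂ _+_ (f≗0 zero λ ()) (∑-single m (f ∘ suc) l (λ p p≢l → f≗0 (suc p) (p≢l ∘ Fin-suc-injective)))

[≡ℕ]-≡ : ∀ {i j} → i ≡ j → [ i ≡ℕ j ] ≡ 1
[≡ℕ]-≡ {zero}  refl = refl
[≡ℕ]-≡ {suc i} refl = [≡ℕ]-≡ {i} refl

[≡ℕ]-≢ : ∀ {i j} → i ≢ j → [ i ≡ℕ j ] ≡ 0
[≡ℕ]-≢ {zero}  {zero}  i≢j = contradiction refl i≢j
[≡ℕ]-≢ {zero}  {suc j} i≢j = refl
[≡ℕ]-≢ {suc i} {zero}  i≢j = refl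
[≡ℕ]-≢ {suc i} {suc j} i≢j = [≡ℕ]-≢ (i≢j ∘ cong suc)

data Position : ℕ → ℕ → Set where
  at    : ∀ k → Position k k
  above : ∀ k → Position (suc k) k
  below : ∀ k → Position k (suc k)
  far   : ∀ {l k} → l ≢ k → l ≢ suc k → suc l ≢ k → Position l k

position : ∀ l k → Position l k
position l k with l ≟ k
... | yes refl = at k
... | no l≢k with l ≟ suc k
...   | yes refl = above k
...   | no l≢1+k with suc l ≟ k
...     | yes refl = below l
...     | no 1+l≢k = far l≢k l≢1+k 1+l≢k

far-apart : ∀ {l k} → l ≢ k → l ≢ suc k → suc l ≢ k → l ≤ suc k → k ≤ suc l → ⊥
far-apart l≢k l≢1+k 1+l≢k l≤1+k k≤1+l =
  l≢k (≤-antisym (≤-pred (≤∧≢⇒< l≤1+k l≢1+k)) (≤-pred (≤∧≢⇒< k≤1+l (1+l≢k ∘ sym))))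

n≢1+n : ∀ n → n ≢ suc n
n≢1+n n = 1+n≢n ∘ sym

n≢2+n : ∀ n → n ≢ suc (suc n)
n≢2+n n = <⇒≢ (m<n⇒m<1+n (n<1+n n))

[≡ℕ]-window : ∀ k L e → (k ≢ L → k ≢ suc L → k ≢ suc (suc L) → e ≡ 0) →
              e ≡ [ k ≡ℕ L ] * e + ([ k ≡ℕ suc L ] * e + [ k ≡ℕ suc (suc L) ] * e)
[≡ℕ]-window k L e outside with k ≟ L
... | yes refl rewrite [≡ℕ]-≡ {L} refl | [≡ℕ]-≢ (n≢1+n L) | [≡ℕ]-≢ (n≢2+n L) =
  sym (trans (+-identityʳ _) (*-identityˡ e))
... | no k≢L with k ≟ suc L
...   | yes refl rewrite [≡ℕ]-≢ (1+n≢n {L}) | [≡ℕ]-≡ {suc L} refl | [≡ℕ]-≢ (n≢1+n (suc L)) =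
  sym (trans (+-identityʳ _) (*-identityˡ e))
...   | no k≢1+L with k ≟ suc (suc L)
...     | yes refl rewrite [≡ℕ]-≢ (n≢2+n L ∘ sym) | [≡ℕ]-≢ (1+n≢n {suc L}) | [≡ℕ]-≡ {suc (suc L)} refl =
  sym (*-identityˡ e)
...     | no k≢2+L rewrite [≡ℕ]-≢ k≢L | [≡ℕ]-≢ k≢1+L | [≡ℕ]-≢ k≢2+L = outside k≢L k≢1+L k≢2+L

div-floor : ∀ N C → 0 < C → N div C * C ≤ N × N < N div C * C + C
div-floor N (suc C) _ = m/n*n≤m N (suc C) ,
  subst₂ _<_ (sym (m≡m%n+[m/n]*n N (suc C))) (+-comm (suc C) _)
             (+-monoˡ-< (N / suc C * suc C) (m%n<n N (suc C)))

div-ceiling : ∀ A C → 0 < C → A ≤ (A + (C ∸ 1)) div C * C × (A + (C ∸ 1)) div C * C ∸ A < C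
div-ceiling A (suc C) 0<C = A≤qC , s≤s (subst (qC ∸ A ≤_) (m+n∸m≡n A C) (∸-monoˡ-≤ A qC≤A+C))
  where
    qC = (A + C) div suc C * suc C
    qC≤A+C = proj₁ (div-floor (A + C) (suc C) 0<C)
    A≤qC : A ≤ qC
    A≤qC = +-cancelʳ-≤ C A qC
             (≤-pred (subst (suc (A + C) ≤_) (+-suc qC C) (proj₂ (div-floor (A + C) (suc C) 0<C))))

remainder-window : ∀ M B P C → C ≤ suc M → P ≤ M + B → M + B < P + C →
                   B ≤ P × P ∸ B ≤ M × suc M ≤ P ∸ B + C
remainder-window M B P C C≤1+M P≤M+B M+B<P+C = B≤P , P∸B≤M , 1+M≤P∸B+C
  where
    B≤P : B ≤ P
    B≤P = +-cancelˡ-≤ C B P (≤-trans (+-monoˡ-≤ B C≤1+M) (subst (suc M + B ≤_) (+-comm P C) M+B<P+C))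
    P∸B≤M : P ∸ B ≤ M
    P∸B≤M = subst (P ∸ B ≤_) (m+n∸n≡m M B) (∸-monoˡ-≤ B P≤M+B)
    1+M≤P∸B+C : suc M ≤ P ∸ B + C
    1+M≤P∸B+C = +-cancelʳ-≤ B (suc M) (P ∸ B + C)
      (subst (suc M + B ≤_) (trans (cong (_+ C) (sym (m∸n+n≡m B≤P))) (xy∙z≈xz∙y (P ∸ B) B C)) M+B<P+C)

refill : ∀ M e B T → e ≤ M → M ∸ e + B ≤ T → M + (T ∸ (M ∸ e + B)) + B ≡ e + T
refill M e B T e≤M deficit≤T = begin
  M + (T ∸ D) + B           ≡⟨ cong (λ x → x + (T ∸ D) + B) (m+[n∸m]≡n e≤M) ⟨
  e + (M ∸ e) + (T ∸ D) + B ≡⟨ cong (_+ B) (+-assoc e (M ∸ e) (T ∸ D)) ⟩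
  e + (M ∸ e + (T ∸ D)) + B ≡⟨ +-assoc e _ B ⟩
  e + (M ∸ e + (T ∸ D) + B) ≡⟨ cong (e +_) (xy∙z≈xz∙y (M ∸ e) (T ∸ D) B) ⟩
  e + (D + (T ∸ D))         ≡⟨ cong (e +_) (m+[n∸m]≡n deficit≤T) ⟩
  e + T                     ∎
  where
    D = M ∸ e + B

fromTop : ℕ → (ℕ → ℕ → ℕ) → ℕ → ℕ
fromTop d f zero    = 0
fromTop d f (suc j) = f (d ∸ j) (fromTop d f j)

downward : ℕ → (ℕ → ℕ → ℕ) → ℕ → ℕ
downward d f k = fromTop d f (suc d ∸ k)

downward-step : ∀ d f k → k ≤ d → downward d f k ≡ f k (downward d f (suc k))
downward-step d f k k≤d = begin
  fromTop d f (suc d ∸ k)               ≡⟨ cong (fromTop d f) (+-∸-assoc 1 k≤d) ⟩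
  f (d ∸ (d ∸ k)) (fromTop d f (d ∸ k)) ≡⟨ cong (λ i → f i (fromTop d f (d ∸ k))) (m∸[m∸n]≡n k≤d) ⟩
  f k (fromTop d f (d ∸ k))             ∎

nStep : (a b c : ℕ → ℕ) → ℕ → ℕ → ℕ
nStep a b c i v = ((degΓ a b c i ∸ 1) + v * b i) div c i

nSeq-downward : ∀ d a b c k → nSeq d a b c k ≡ downward d (nStep a b c) k
nSeq-downward d a b c k = from-top (suc d ∸ k)
  where
    from-top : ∀ j → nFromTop d a b c j ≡ fromTop d (nStep a b c) j
    from-top zero    = refl
    from-top (suc j) = cong (nStep a b c (d ∸ j)) (from-top j)

module Toppling {n : ℕ} (E : Mult n) where

  Steps : Config n → Config n → Set
  Steps = Star (Topple E)

  CanTopple : Config n → Fin n → Set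
  CanTopple x i = outdeg E (suc i) ≤ lookup x i

  toppled : Config n → Fin n → Config n
  toppled x i = tabulate (λ j → (lookup x j + E (suc i) (suc j)) ∸ removed E i j)

  removed-self : ∀ i → removed E i i ≡ outdeg E (suc i)
  removed-self i with i ≟ᶠ i
  ... | yes _   = refl
  ... | no i≢i = contradiction refl i≢i

  removed-other : ∀ {i j} → i ≢ j → removed E i j ≡ 0
  removed-other {i} {j} i≢j with i ≟ᶠ j
  ... | yes i≡j = contradiction i≡j i≢j
  ... | no _    = refl

  lookup-toppled : ∀ x i → CanTopple x i → ∀ j →
                   lookup (toppled x i) j + removed E i j ≡ lookup x j + E (suc i) (suc j)
  lookup-toppled x i can j =
    trans (cong (_+ removed E i j) (lookup∘tabulate _ j)) (m∸n+n≡m removed≤)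
    where
      removed≤ : removed E i j ≤ lookup x j + E (suc i) (suc j)
      removed≤ with i ≟ᶠ j
      ... | yes refl = ≤-trans can (m≤m+n _ _)
      ... | no _     = z≤n

  lookup-toppled-other : ∀ x {i j} → i ≢ j → lookup (toppled x i) j ≡ lookup x j + E (suc i) (suc j)
  lookup-toppled-other x {i} {j} i≢j =
    trans (lookup∘tabulate _ j) (cong (lookup x j + E (suc i) (suc j) ∸_) (removed-other i≢j))

  can-topple-after : ∀ x {i j} → i ≢ j → CanTopple x j → CanTopple (toppled x i) j
  can-topple-after x i≢j can =
    ≤-trans can (subst (_ ≤_) (sym (lookup-toppled-other x i≢j)) (m≤m+n _ _))

  toppled-unique : ∀ x i {y} → CanTopple x i →
                   (∀ j → lookup y j + removed E i j ≡ lookup x j + E (suc i) (suc j)) →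
                   toppled x i ≡ y
  toppled-unique x i can balance =
    vec-ext λ j → +-cancelʳ-≡ _ _ _ (trans (lookup-toppled x i can j) (sym (balance j)))

  lookup-toppled² : ∀ x i j → CanTopple x i → CanTopple (toppled x i) j → ∀ l →
    lookup (toppled (toppled x i) j) l + (removed E i l + removed E j l)
      ≡ lookup x l + (E (suc i) (suc l) + E (suc j) (suc l))
  lookup-toppled² x i j can-i can-j l = begin
    lookup (toppled (toppled x i) j) l + (rᵢ + rⱼ) ≡⟨ x∙yz≈xz∙y _ rᵢ rⱼ ⟩
    lookup (toppled (toppled x i) j) l + rⱼ + rᵢ   ≡⟨ cong (_+ rᵢ) (lookup-toppled (toppled x i) j can-j l) ⟩
    lookup (toppled x i) l + eⱼ + rᵢ               ≡⟨ xy∙z≈xz∙y _ eⱼ rᵢ ⟩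
    lookup (toppled x i) l + rᵢ + eⱼ               ≡⟨ cong (_+ eⱼ) (lookup-toppled x i can-i l) ⟩
    lookup x l + eᵢ + eⱼ                           ≡⟨ +-assoc _ eᵢ eⱼ ⟩
    lookup x l + (eᵢ + eⱼ)                         ∎
    where
      rᵢ = removed E i l
      rⱼ = removed E j l
      eᵢ = E (suc i) (suc l)
      eⱼ = E (suc j) (suc l)

  toppled-comm : ∀ x i j → CanTopple x i → CanTopple x j →
                 toppled (toppled x i) j ≡ toppled (toppled x j) i
  toppled-comm x i j can-i can-j with i ≟ᶠ j
  ... | yes refl = refl
  ... | no i≢j   = vec-ext λ l → +-cancelʳ-≡ _ _ _ (both-orders l)
    where
      both-orders : ∀ l →
        lookup (toppled (toppled x i) j) l + (removed E i l + removed E j l)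
          ≡ lookup (toppled (toppled x j) i) l + (removed E i l + removed E j l)
      both-orders l = begin
        lookup (toppled (toppled x i) j) l + (removed E i l + removed E j l)
          ≡⟨ lookup-toppled² x i j can-i (can-topple-after x i≢j can-j) l ⟩
        lookup x l + (E (suc i) (suc l) + E (suc j) (suc l))
          ≡⟨ cong (lookup x l +_) (+-comm (E (suc i) (suc l)) _) ⟩
        lookup x l + (E (suc j) (suc l) + E (suc i) (suc l))
          ≡⟨ lookup-toppled² x j i can-j (can-topple-after x (i≢j ∘ sym) can-i) l ⟨
        lookup (toppled (toppled x j) i) l + (removed E j l + removed E i l)
          ≡⟨ cong (lookup (toppled (toppled x j) i) l +_) (+-comm (removed E j l) _) ⟩
        lookup (toppled (toppled x j) i) l + (removed E i l + removed E j l) ∎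

  stable-confluent₁ : ∀ {x x′ y} → Steps x y → Stable E y → Topple E x x′ → Steps x′ y
  stable-confluent₁ ε y-stable (topple _ i can) = contradiction can (<⇒≱ (y-stable i))
  stable-confluent₁ (topple _ j can-j ◅ rest) y-stable (topple x i can-i) with i ≟ᶠ j
  ... | yes refl = rest
  ... | no i≢j   =
    topple _ j (can-topple-after x i≢j can-j) ◅
    subst (λ z → Steps z _) (sym (toppled-comm x i j can-i can-j))
      (stable-confluent₁ rest y-stable (topple _ i (can-topple-after x (i≢j ∘ sym) can-i)))

  stable-confluent : ∀ {x x′ y} → Steps x y → Stable E y → Steps x x′ → Steps x′ y
  stable-confluent x→y y-stable ε            = x→y
  stable-confluent x→y y-stable (step ◅ x→x′) =
    stable-confluent (stable-confluent₁ x→y y-stable step) y-stable x→x′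

  can-topple-+ᶜ : ∀ x i h → CanTopple x i → CanTopple (x +ᶜ h) i
  can-topple-+ᶜ x i h can = ≤-trans can (subst (_ ≤_) (sym (lookup-+ᶜ x h i)) (m≤m+n _ _))

  toppled-+ᶜ : ∀ x i h → CanTopple x i → toppled (x +ᶜ h) i ≡ toppled x i +ᶜ h
  toppled-+ᶜ x i h can = toppled-unique (x +ᶜ h) i (can-topple-+ᶜ x i h can) λ l → begin
    lookup (toppled x i +ᶜ h) l + removed E i l         ≡⟨ cong (_+ removed E i l) (lookup-+ᶜ (toppled x i) h l) ⟩
    lookup (toppled x i) l + lookup h l + removed E i l ≡⟨ xy∙z≈xz∙y (lookup (toppled x i) l) _ _ ⟩
    lookup (toppled x i) l + removed E i l + lookup h l ≡⟨ cong (_+ lookup h l) (lookup-toppled x i can l) ⟩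
    lookup x l + E (suc i) (suc l) + lookup h l         ≡⟨ xy∙z≈xz∙y (lookup x l) _ _ ⟩
    lookup x l + lookup h l + E (suc i) (suc l)         ≡⟨ cong (_+ E (suc i) (suc l)) (lookup-+ᶜ x h l) ⟨
    lookup (x +ᶜ h) l + E (suc i) (suc l)               ∎

  Steps-+ᶜ : ∀ h {x y} → Steps x y → Steps (x +ᶜ h) (y +ᶜ h)
  Steps-+ᶜ h = gmap (_+ᶜ h) step
    where
      step : ∀ {x y} → Topple E x y → Topple E (x +ᶜ h) (y +ᶜ h)
      step (topple x i can) =
        subst (Topple E (x +ᶜ h)) (toppled-+ᶜ x i h can) (topple (x +ᶜ h) i (can-topple-+ᶜ x i h can))

  ∑-removed : ∀ (χ : Fin n → ℕ) l → ∑ n (λ p → χ p * removed E p l) ≡ χ l * outdeg E (suc l)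
  ∑-removed χ l =
    trans (∑-single n _ l λ p p≢l → trans (cong (χ p *_) (removed-other p≢l)) (*-zeroʳ (χ p)))
          (cong (χ l *_) (removed-self l))

  -- The balance equation says that y is x with every vertex p such that κ p ≡ i toppled once.
  fire-level-set : (κ : Fin n → ℕ) (i : ℕ) {x y : Config n} →
    (∀ p → κ p ≡ i → CanTopple x p) →
    (∀ l → lookup y l + [ κ l ≡ℕ i ] * outdeg E (suc l)
             ≡ lookup x l + ∑ n (λ p → [ κ p ≡ℕ i ] * E (suc p) (suc l))) →
    Steps x y
  fire-level-set κ i {y = y} can balance =
    fire n id id can λ l → trans (cong (lookup y l +_) (∑-removed χ l)) (balance l)
    where
      χ : Fin n → ℕ
      χ p = [ κ p ≡ℕ i ]

      fire-first : ∀ y′ R x S x′ r e → y′ + (1 * r + R) ≡ x + (1 * e + S) →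
                   x′ + r ≡ x + e → y′ + R ≡ x′ + S
      fire-first y′ R x S x′ r e balance′ toppled′ = +-cancelʳ-≡ r _ _ (begin
        y′ + R + r        ≡⟨ x∙yz≈xz∙y y′ r R ⟨
        y′ + (r + R)      ≡⟨ cong (λ k → y′ + (k + R)) (*-identityˡ r) ⟨
        y′ + (1 * r + R)  ≡⟨ balance′ ⟩
        x + (1 * e + S)   ≡⟨ cong (λ k → x + (k + S)) (*-identityˡ e) ⟩
        x + (e + S)       ≡⟨ +-assoc x e S ⟨
        x + e + S         ≡⟨ cong (_+ S) toppled′ ⟨
        x′ + r + S        ≡⟨ xy∙z≈xz∙y x′ r S ⟩
        x′ + S + r        ∎)

      FirstWeighted : ∀ {m} → (Fin (suc m) → Fin n) → Config n → Fin n → ℕ → Set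
      FirstWeighted {m} ι x l k =
        lookup y l + (k * removed E (ι zero) l + ∑ m (λ p → χ (ι (suc p)) * removed E (ι (suc p)) l))
          ≡ lookup x l + (k * E (suc (ι zero)) (suc l) + ∑ m (λ p → χ (ι (suc p)) * E (suc (ι (suc p))) (suc l)))

      fire : ∀ m (ι : Fin m → Fin n) → Injective _≡_ _≡_ ι → ∀ {x} →
             (∀ p → κ (ι p) ≡ i → CanTopple x (ι p)) →
             (∀ l → lookup y l + ∑ m (λ p → χ (ι p) * removed E (ι p) l)
                      ≡ lookup x l + ∑ m (λ p → χ (ι p) * E (suc (ι p)) (suc l))) →
             Steps x y
      fire zero    ι ι-inj {x} can balance′ =
        subst (Steps x) (vec-ext λ l → +-cancelʳ-≡ 0 _ _ (sym (balance′ l))) ε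
      fire (suc m) ι ι-inj {x} can balance′ with κ (ι zero) ≟ i
      ... | no  κ≢i = fire m (ι ∘ suc) (Fin-suc-injective ∘ ι-inj) (can ∘ suc) λ l →
        subst (FirstWeighted ι x l) ([≡ℕ]-≢ κ≢i) (balance′ l)
      ... | yes κ≡i = topple x (ι zero) (can zero κ≡i) ◅
        fire m (ι ∘ suc) (Fin-suc-injective ∘ ι-inj)
          (λ p κ≡i′ → can-topple-after x (ι-zero≢ p) (can (suc p) κ≡i′))
          λ l → fire-first (lookup y l) _ (lookup x l) _ (lookup (toppled x (ι zero)) l)
                           (removed E (ι zero) l) (E (suc (ι zero)) (suc l))
            (subst (FirstWeighted ι x l) ([≡ℕ]-≡ κ≡i) (balance′ l))
            (lookup-toppled x (ι zero) (can zero κ≡i) l)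
        where
          ι-zero≢ : ∀ p → ι zero ≢ ι (suc p)
          ι-zero≢ p eq with ι-inj eq
          ... | ()

  ideal-∋-dominating : ∀ {I : Config n → Set} {g m} → IsIdeal E I → I g → Stable E m →
                       (∀ j → lookup g j ≤ lookup m j) → I m
  ideal-∋-dominating {g = g} {m} (_ , closed) g∈I m-stable g≤m =
    closed g δ m g∈I δ-stable (subst (λ z → Steps z m) (sym g+δ≡m) ε , m-stable)
    where
      δ = tabulate (λ j → lookup m j ∸ lookup g j)
      δ-stable : Stable E δ
      δ-stable j = subst (_< outdeg E (suc j)) (sym (lookup∘tabulate _ j))
                         (≤-<-trans (m∸n≤m (lookup m j) (lookup g j)) (m-stable j))
      g+δ≡m : g +ᶜ δ ≡ m
      g+δ≡m = vec-ext λ j → trans (lookup-+ᶜ g δ j)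
                (trans (cong (lookup g j +_) (lookup∘tabulate _ j)) (m+[n∸m]≡n (g≤m j)))

  absorbs-one⇒absorbs-all : ∀ {G : Config n → Set} {e m} → IsMinimalIdeal E G → G m →
                            Steps (e +ᶜ m) m → ∀ g → G g → Steps (e +ᶜ g) g
  absorbs-one⇒absorbs-all {G} {e} {m} ((G-stable , G-closed) , _ , minimal) m∈G e+m→m g g∈G =
    proj₂ (minimal Absorbing absorbing-ideal (m , m∈G , e+m→m) (λ _ → proj₁) g g∈G)
    where
      Absorbing : Config n → Set
      Absorbing z = G z × Steps (e +ᶜ z) z

      absorbing-closed : ∀ x y w → Absorbing x → Stable E y → Stab E (x +ᶜ y) w → Absorbing w
      absorbing-closed x y w (x∈G , e+x→x) y-stable (x+y→w , w-stable) =
        G-closed x y w x∈G y-stable (x+y→w , w-stable) ,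
        stable-confluent e+x+y→w w-stable e+x+y→e+w
        where
          e+x+y→w : Steps (e +ᶜ (x +ᶜ y)) w
          e+x+y→w = subst (λ z → Steps z w) (+ᶜ-assoc e x y) (Steps-+ᶜ y e+x→x ◅◅ x+y→w)
          e+x+y→e+w : Steps (e +ᶜ (x +ᶜ y)) (e +ᶜ w)
          e+x+y→e+w = subst₂ Steps (+ᶜ-comm (x +ᶜ y) e) (+ᶜ-comm w e) (Steps-+ᶜ e x+y→w)

      absorbing-ideal : IsIdeal E Absorbing
      absorbing-ideal = (λ z → G-stable z ∘ proj₁) , absorbing-closed

module Layered {n : ℕ} (E : Mult n) (dist : Fin (suc n) → ℕ) (d : ℕ) (a b c : ℕ → ℕ)
               (R : SinkDistanceRegular E dist d a b c) where
  open SinkDistanceRegular R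
  open Toppling E public

  deg : ℕ → ℕ
  deg = degΓ a b c

  dist-sink : dist zero ≡ 0
  dist-sink with dist zero | dist-is-δ zero
  ... | zero  | _            = refl
  ... | suc _ | _ , shortest = contradiction nil (shortest 0 (s≤s z≤n))

  dist-nonsink : ∀ j → 1 ≤ dist (suc j)
  dist-nonsink j with dist (suc j) | dist-is-δ (suc j)
  ... | zero  | () , _
  ... | suc _ | _ = s≤s z≤n

  no-edge-far : ∀ v w → dist w ≢ dist v → dist w ≢ suc (dist v) → suc (dist w) ≢ dist v → E v w ≡ 0
  no-edge-far v w ne₁ ne₂ ne₃ = n≤0⇒n≡0 (≮⇒≥ λ edge →
    far-apart ne₁ ne₂ ne₃ (proj₁ (edge-layers v w edge)) (proj₂ (edge-layers v w edge)))

  outdeg-layer : ∀ v {L} → dist v ≡ suc L → outdeg E v ≡ deg (suc L)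
  outdeg-layer v {L} dv = begin
    ∑ (suc n) (E v)
      ≡⟨ ∑-cong (suc n) (λ w → [≡ℕ]-window (dist w) L (E v w) (outside w)) ⟩
    ∑ (suc n) (λ w → lower w + (level w + upper w))
      ≡⟨ ∑-distrib-+ (suc n) lower (λ w → level w + upper w) ⟩
    outTo E dist v L + ∑ (suc n) (λ w → level w + upper w)
      ≡⟨ cong (outTo E dist v L +_) (∑-distrib-+ (suc n) level upper) ⟩
    outTo E dist v L + (outTo E dist v (suc L) + outTo E dist v (suc (suc L)))
      ≡⟨ cong₂ _+_ (out-below L dv) (cong₂ _+_ (a-out v L dv) (b-out v L dv)) ⟩
    c (suc L) + (a (suc L) + b (suc L))
      ≡⟨ +-comm (c (suc L)) _ ⟩
    deg (suc L) ∎
    where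
      lower level upper : Fin (suc n) → ℕ
      lower w = [ dist w ≡ℕ L ] * E v w
      level w = [ dist w ≡ℕ suc L ] * E v w
      upper w = [ dist w ≡ℕ suc (suc L) ] * E v w
      outside : ∀ w → dist w ≢ L → dist w ≢ suc L → dist w ≢ suc (suc L) → E v w ≡ 0
      outside w ne₁ ne₂ ne₃ = no-edge-far v w (ne₂ ∘ (λ eq → trans eq dv))
        (ne₃ ∘ (λ eq → trans eq (cong suc dv))) (ne₁ ∘ suc-injective ∘ (λ eq → trans eq dv))
      out-below : ∀ K → dist v ≡ suc K → outTo E dist v K ≡ c (suc K)
      out-below zero    dv = c-one v dv
      out-below (suc K) dv = c-out v K dv

  outdeg-nonsink : ∀ j → outdeg E (suc j) ≡ deg (dist (suc j))
  outdeg-nonsink j with dist (suc j) in dj | dist-nonsink j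
  ... | suc L | _ = outdeg-layer (suc j) dj

  inFrom-far : ∀ v i → dist v ≢ i → dist v ≢ suc i → suc (dist v) ≢ i → inFrom E dist v i ≡ 0
  inFrom-far v i ne₁ ne₂ ne₃ = ∑-zero (suc n) term
    where
      term : ∀ w → [ dist w ≡ℕ i ] * E w v ≡ 0
      term w with dist w ≟ i
      ... | no dw≢i = cong (_* E w v) ([≡ℕ]-≢ dw≢i)
      ... | yes refl = trans (cong ([ dist w ≡ℕ dist w ] *_)
                               (no-edge-far w v ne₁ ne₂ ne₃)) (*-zeroʳ [ dist w ≡ℕ dist w ])

  inFrom-nonsink : ∀ l i → ∑ n (λ p → [ dist (suc p) ≡ℕ suc i ] * E (suc p) (suc l))
                             ≡ inFrom E dist (suc l) (suc i)
  inFrom-nonsink l i =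
    cong (λ k → [ k ≡ℕ suc i ] * E zero (suc l) + ∑ n (λ p → [ dist (suc p) ≡ℕ suc i ] * E (suc p) (suc l)))
         (sym dist-sink)

  b+c≤deg : ∀ k → b k + c k ≤ deg k
  b+c≤deg k = ≤-trans (m≤n+m _ (a k)) (≤-reflexive (sym (+-assoc (a k) (b k) (c k))))

  c≤deg : ∀ k → c k ≤ deg k
  c≤deg k = m≤n+m (c k) (a k + b k)

  cfg : (ℕ → ℕ) → Config n
  cfg u = tabulate (λ j → u (dist (suc j)))

  lookup-cfg : ∀ u j → lookup (cfg u) j ≡ u (dist (suc j))
  lookup-cfg u j = lookup∘tabulate (λ j → u (dist (suc j))) j

  _≐_ : (ℕ → ℕ) → (ℕ → ℕ) → Set
  u ≐ v = ∀ k → 1 ≤ k → k ≤ d → u k ≡ v k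

  cfg-cong : ∀ {u v} → u ≐ v → cfg u ≡ cfg v
  cfg-cong u≐v = tabulate-cong λ j → u≐v _ (dist-nonsink j) (d-bound (suc j))

  _⇝_ : (ℕ → ℕ) → (ℕ → ℕ) → Set
  u ⇝ v = Steps (cfg u) (cfg v)

  ⇝-≐ʳ : ∀ u {v w} → u ⇝ v → v ≐ w → u ⇝ w
  ⇝-≐ʳ _ u⇝v v≐w = subst (Steps _) (cfg-cong v≐w) u⇝v

  fireLayer : (ℕ → ℕ) → ℕ → ℕ → ℕ
  fireLayer u k l with position l k
  ... | at _      = u l ∸ (b l + c l)
  ... | above _   = u l + c l
  ... | below _   = u l + b l
  ... | far _ _ _ = u l

  fireLayer-at : ∀ u k → fireLayer u k k ≡ u k ∸ (b k + c k)
  fireLayer-at u k with position k k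
  ... | at _       = refl
  ... | far ne _ _ = contradiction refl ne

  fireLayer-above : ∀ u k → fireLayer u k (suc k) ≡ u (suc k) + c (suc k)
  fireLayer-above u k with position (suc k) k
  ... | above _    = refl
  ... | far _ ne _ = contradiction refl ne

  fireLayer-below : ∀ u l → fireLayer u (suc l) l ≡ u l + b l
  fireLayer-below u l with position l (suc l)
  ... | below _    = refl
  ... | far _ _ ne = contradiction refl ne

  fireLayer-other : ∀ u k l → l ≢ k → l ≢ suc k → suc l ≢ k → fireLayer u k l ≡ u l
  fireLayer-other u k l ne₁ ne₂ ne₃ with position l k
  ... | at _      = contradiction refl ne₁
  ... | above _   = contradiction refl ne₂
  ... | below _   = contradiction refl ne₃
  ... | far _ _ _ = refl

  fireLayer-balance : ∀ u i v {L} → dist v ≡ suc L → b (suc i) + c (suc i) ≤ u (suc i) →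
    fireLayer u (suc i) (suc L) + [ suc L ≡ℕ suc i ] * outdeg E v ≡ u (suc L) + inFrom E dist v (suc i)
  fireLayer-balance u i v {L} dv room with position (suc L) (suc i)
  ... | at _ rewrite [≡ℕ]-≡ {L} refl | outdeg-layer v dv | a-in v i dv = begin
    u (suc i) ∸ (b (suc i) + c (suc i)) + 1 * (a (suc i) + b (suc i) + c (suc i))
      ≡⟨ cong (u (suc i) ∸ (b (suc i) + c (suc i)) +_) (trans (*-identityˡ _) (+-assoc (a (suc i)) _ _)) ⟩
    u (suc i) ∸ (b (suc i) + c (suc i)) + (a (suc i) + (b (suc i) + c (suc i)))
      ≡⟨ x∙yz≈xz∙y (u (suc i) ∸ (b (suc i) + c (suc i))) (a (suc i)) _ ⟩
    u (suc i) ∸ (b (suc i) + c (suc i)) + (b (suc i) + c (suc i)) + a (suc i)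
      ≡⟨ cong (_+ a (suc i)) (m∸n+n≡m room) ⟩
    u (suc i) + a (suc i) ∎
  ... | above _ rewrite [≡ℕ]-≢ (1+n≢n {suc i}) | c-in v i dv = +-identityʳ _
  ... | below _ rewrite [≡ℕ]-≢ (n≢1+n (suc L)) | b-in v L dv = +-identityʳ _
  ... | far ne₁ ne₂ ne₃ rewrite [≡ℕ]-≢ ne₁ | inFrom-far v (suc i) (ne₁ ∘ trans (sym dv))
          (ne₂ ∘ trans (sym dv)) (ne₃ ∘ trans (cong suc (sym dv))) = refl

  fire-layer : ∀ u i → deg (suc i) ≤ u (suc i) → u ⇝ fireLayer u (suc i)
  fire-layer u i deg≤u = fire-level-set (λ p → dist (suc p)) (suc i) can balance
    where
      can : ∀ p → dist (suc p) ≡ suc i → CanTopple (cfg u) p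
      can p dp = subst₂ _≤_ (sym (outdeg-layer (suc p) dp))
                   (trans (cong u (sym dp)) (sym (lookup-cfg u p))) deg≤u

      layer-balance : ∀ l → fireLayer u (suc i) (dist (suc l)) + [ dist (suc l) ≡ℕ suc i ] * outdeg E (suc l)
                              ≡ u (dist (suc l)) + inFrom E dist (suc l) (suc i)
      layer-balance l with dist (suc l) in dl | dist-nonsink l
      ... | suc L | _ = fireLayer-balance u i (suc l) dl (≤-trans (b+c≤deg (suc i)) deg≤u)

      balance : ∀ l → lookup (cfg (fireLayer u (suc i))) l + [ dist (suc l) ≡ℕ suc i ] * outdeg E (suc l)
                      ≡ lookup (cfg u) l + ∑ n (λ p → [ dist (suc p) ≡ℕ suc i ] * E (suc p) (suc l))
      balance l = begin
        lookup (cfg (fireLayer u (suc i))) l + [ dist (suc l) ≡ℕ suc i ] * outdeg E (suc l)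
          ≡⟨ cong (_+ [ dist (suc l) ≡ℕ suc i ] * outdeg E (suc l)) (lookup-cfg (fireLayer u (suc i)) l) ⟩
        fireLayer u (suc i) (dist (suc l)) + [ dist (suc l) ≡ℕ suc i ] * outdeg E (suc l)
          ≡⟨ layer-balance l ⟩
        u (dist (suc l)) + inFrom E dist (suc l) (suc i)
          ≡⟨ cong₂ _+_ (lookup-cfg u l) (inFrom-nonsink l i) ⟨
        lookup (cfg u) l + ∑ n (λ p → [ dist (suc p) ≡ℕ suc i ] * E (suc p) (suc l)) ∎

  -- The layer values reached from u by firing the layers k, k + 1, …, d in turn, s times over.
  cascade : ℕ → (ℕ → ℕ) → ℕ → ℕ → ℕ
  cascade s u k l with position l k
  ... | at _    = u l ∸ s * c l
  ... | below _ = u l + s * b l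
  ... | _       = u l

  cascade-at : ∀ s u k → cascade s u k k ≡ u k ∸ s * c k
  cascade-at s u k with position k k
  ... | at _       = refl
  ... | far ne _ _ = contradiction refl ne

  cascade-below : ∀ s u k → cascade s u (suc k) k ≡ u k + s * b k
  cascade-below s u k with position k (suc k)
  ... | below _    = refl
  ... | far _ _ ne = contradiction refl ne

  cascade-other : ∀ s u k l → l ≢ k → suc l ≢ k → cascade s u k l ≡ u l
  cascade-other s u k l ne₁ ne₂ with position l k
  ... | at _      = contradiction refl ne₁
  ... | above _   = refl
  ... | below _   = contradiction refl ne₂
  ... | far _ _ _ = refl

  cascade-beyond : ∀ s u k l → k < l → cascade s u k l ≡ u l
  cascade-beyond s u k l k<l = cascade-other s u k l (>⇒≢ k<l) (>⇒≢ (m<n⇒m<1+n k<l))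

  cascade-beneath : ∀ s u k l → suc l < k → cascade s u k l ≡ u l
  cascade-beneath s u k l l+1<k = cascade-other s u k l (<⇒≢ (<-trans (n<1+n l) l+1<k)) (<⇒≢ l+1<k)

  cascade-zero : ∀ u k → u ≐ cascade 0 u k
  cascade-zero u k l _ _ with position l k
  ... | at _      = refl
  ... | above _   = refl
  ... | below _   = sym (+-identityʳ (u l))
  ... | far _ _ _ = refl

  cascade-suc : ∀ s u k → cascade s (cascade 1 u k) k ≐ cascade (suc s) u k
  cascade-suc s u k l _ _ with position l k
  ... | at _ = begin
    cascade 1 u k k ∸ s * c k     ≡⟨ cong (_∸ s * c k) (cascade-at 1 u k) ⟩
    u k ∸ 1 * c k ∸ s * c k       ≡⟨ ∸-+-assoc (u k) (1 * c k) (s * c k) ⟩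
    u k ∸ (1 * c k + s * c k)     ≡⟨ cong (λ x → u k ∸ (x + s * c k)) (*-identityˡ (c k)) ⟩
    u k ∸ (c k + s * c k)         ∎
  ... | above _ = cascade-beyond 1 u k (suc k) (n<1+n k)
  ... | below _ = begin
    cascade 1 u (suc l) l + s * b l ≡⟨ cong (_+ s * b l) (cascade-below 1 u l) ⟩
    u l + 1 * b l + s * b l         ≡⟨ +-assoc (u l) (1 * b l) (s * b l) ⟩
    u l + (1 * b l + s * b l)       ≡⟨ cong (λ x → u l + (x + s * b l)) (*-identityˡ (b l)) ⟩
    u l + (b l + s * b l)           ∎
  ... | far ne₁ _ ne₃ = cascade-other 1 u k l ne₁ ne₃

  fire-then-cascade : ∀ u k → b k + c k ≤ u k →
                      cascade 1 (fireLayer u k) (suc k) ≐ cascade 1 u k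
  fire-then-cascade u k room l _ _ with position l k
  ... | at _ = begin
    cascade 1 (fireLayer u k) (suc k) k ≡⟨ cascade-below 1 (fireLayer u k) k ⟩
    fireLayer u k k + 1 * b k           ≡⟨ cong₂ _+_ (fireLayer-at u k) (*-identityˡ (b k)) ⟩
    u k ∸ (b k + c k) + b k             ≡⟨ cong (λ x → u k ∸ x + b k) (+-comm (b k) (c k)) ⟩
    u k ∸ (c k + b k) + b k             ≡⟨ cong (_+ b k) (∸-+-assoc (u k) (c k) (b k)) ⟨
    u k ∸ c k ∸ b k + b k               ≡⟨ m∸n+n≡m (subst (_≤ u k ∸ c k) (m+n∸n≡m (b k) (c k)) (∸-monoˡ-≤ (c k) room)) ⟩
    u k ∸ c k                           ≡⟨ cong (u k ∸_) (*-identityˡ (c k)) ⟨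
    u k ∸ 1 * c k                       ∎
  ... | above _ = begin
    cascade 1 (fireLayer u k) (suc k) (suc k) ≡⟨ cascade-at 1 (fireLayer u k) (suc k) ⟩
    fireLayer u k (suc k) ∸ 1 * c (suc k)     ≡⟨ cong₂ _∸_ (fireLayer-above u k) (*-identityˡ (c (suc k))) ⟩
    u (suc k) + c (suc k) ∸ c (suc k)         ≡⟨ m+n∸n≡m (u (suc k)) (c (suc k)) ⟩
    u (suc k)                                 ∎
  ... | below _ = begin
    cascade 1 (fireLayer u (suc l)) (suc (suc l)) l ≡⟨ cascade-beneath 1 (fireLayer u (suc l)) (suc (suc l)) l (n<1+n (suc l)) ⟩
    fireLayer u (suc l) l                           ≡⟨ fireLayer-below u l ⟩
    u l + b l                                       ≡⟨ cong (u l +_) (*-identityˡ (b l)) ⟨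
    u l + 1 * b l                                   ∎
  ... | far ne₁ ne₂ ne₃ with l ≟ suc (suc k)
  ...   | yes refl = trans (cascade-beyond 1 (fireLayer u k) (suc k) (suc (suc k)) (n<1+n (suc k)))
                           (fireLayer-other u k (suc (suc k)) ne₁ ne₂ ne₃)
  ...   | no l≢2+k = trans (cascade-other 1 (fireLayer u k) (suc k) l ne₂ (ne₁ ∘ suc-injective))
                           (fireLayer-other u k l ne₁ ne₂ ne₃)

  cascade-once : ∀ j u i → suc i + j ≡ d → deg (suc i) ≤ u (suc i) →
                 (∀ l → suc i < l → l ≤ d → deg l ≤ u l + c l) → u ⇝ cascade 1 u (suc i)
  cascade-once zero u i top deg≤u _ = ⇝-≐ʳ u (fire-layer u i deg≤u) top-layer
    where
      i+1≡d : suc i ≡ d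
      i+1≡d = trans (sym (+-identityʳ (suc i))) top

      top-layer : fireLayer u (suc i) ≐ cascade 1 u (suc i)
      top-layer l _ l≤d with position l (suc i)
      ... | at _      = cong₂ (λ x y → u l ∸ (x + y)) (trans (cong b i+1≡d) b-top) (sym (*-identityˡ (c l)))
      ... | above _   = contradiction (≤-trans l≤d (≤-reflexive (sym i+1≡d))) 1+n≰n
      ... | below _   = cong (u l +_) (sym (*-identityˡ (b l)))
      ... | far _ _ _ = refl
  cascade-once (suc j) u i below-top deg≤u upper =
    fire-layer u i deg≤u ◅◅
    ⇝-≐ʳ (fireLayer u (suc i)) (cascade-once j (fireLayer u (suc i)) (suc i) 2+i+j≡d deg≤next upper′)
         (fire-then-cascade u (suc i) (≤-trans (b+c≤deg (suc i)) deg≤u))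
    where
      2+i+j≡d : suc (suc i) + j ≡ d
      2+i+j≡d = trans (sym (+-suc (suc i) j)) below-top

      2+i≤d : suc (suc i) ≤ d
      2+i≤d = subst (suc (suc i) ≤_) 2+i+j≡d (m≤m+n (suc (suc i)) j)

      deg≤next : deg (suc (suc i)) ≤ fireLayer u (suc i) (suc (suc i))
      deg≤next = subst (deg (suc (suc i)) ≤_) (sym (fireLayer-above u (suc i)))
                       (upper (suc (suc i)) (n<1+n (suc i)) 2+i≤d)

      upper′ : ∀ l → suc (suc i) < l → l ≤ d → deg l ≤ fireLayer u (suc i) l + c l
      upper′ l 2+i<l l≤d = subst (λ x → deg l ≤ x + c l)
        (sym (fireLayer-other u (suc i) l (>⇒≢ (<-trans (n<1+n (suc i)) 2+i<l)) (>⇒≢ 2+i<l)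
                                  (>⇒≢ (<-trans (<-trans (n<1+n (suc i)) 2+i<l) (n<1+n l)))))
        (upper l (<-trans (n<1+n (suc i)) 2+i<l) l≤d)

  cascades : ∀ s u i → suc i ≤ d → deg (suc i) + s * c (suc i) ≤ u (suc i) + c (suc i) →
             (∀ l → suc i < l → l ≤ d → deg l ≤ u l + c l) → u ⇝ cascade s u (suc i)
  cascades zero    u i _ _ _ = ⇝-≐ʳ u ε (cascade-zero u (suc i))
  cascades (suc s) u i k≤d room upper =
    cascade-once (d ∸ k) u i (m+[n∸m]≡n k≤d) deg≤u upper ◅◅
    ⇝-≐ʳ once (cascades s once i k≤d room′ upper′) (cascade-suc s u k)
    where
      k = suc i
      once = cascade 1 u k

      deg+sc≤u : deg k + s * c k ≤ u k
      deg+sc≤u = +-cancelʳ-≤ (c k) _ _ (subst (_≤ u k + c k) (x∙yz≈xz∙y (deg k) (c k) (s * c k)) room)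

      deg≤u : deg k ≤ u k
      deg≤u = ≤-trans (m≤m+n _ _) deg+sc≤u

      once+c≡u : once k + c k ≡ u k
      once+c≡u = begin
        once k + c k        ≡⟨ cong (_+ c k) (cascade-at 1 u k) ⟩
        u k ∸ 1 * c k + c k ≡⟨ cong (λ x → u k ∸ x + c k) (*-identityˡ (c k)) ⟩
        u k ∸ c k + c k     ≡⟨ m∸n+n≡m (≤-trans (c≤deg k) deg≤u) ⟩
        u k                 ∎

      room′ : deg k + s * c k ≤ once k + c k
      room′ = subst (deg k + s * c k ≤_) (sym once+c≡u) deg+sc≤u

      upper′ : ∀ l → k < l → l ≤ d → deg l ≤ once l + c l
      upper′ l k<l l≤d = subst (λ x → deg l ≤ x + c l) (sym (cascade-beyond 1 u k l k<l)) (upper l k<l l≤d)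

  -- Settle the layers from the top down, with t k cascades at layer k.
  reach-by-cascades : (z t x : ℕ → ℕ) → (∀ k → 1 ≤ k → k ≤ d → deg k ≤ z k + c k) →
    (∀ k → 1 ≤ k → k ≤ d → x k + t (suc k) * b k ≡ z k + t k * c k) → x ⇝ z
  reach-by-cascades z t x critical balanced =
    sweep d x ≤-refl (λ l d<l l≤d → contradiction l≤d (<⇒≱ d<l)) top-balanced
      (λ l 1≤l l<d → balanced l 1≤l (<⇒≤ l<d))
    where
      top-balanced : 1 ≤ d → x d ≡ z d + t d * c d
      top-balanced 1≤d = begin
        x d                     ≡⟨ +-identityʳ (x d) ⟨
        x d + 0                 ≡⟨ cong (x d +_) (*-zeroʳ (t (suc d))) ⟨
        x d + t (suc d) * 0     ≡⟨ cong (λ y → x d + t (suc d) * y) b-top ⟨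
        x d + t (suc d) * b d   ≡⟨ balanced d 1≤d ≤-refl ⟩
        z d + t d * c d         ∎

      sweep : ∀ k u → k ≤ d → (∀ l → k < l → l ≤ d → u l ≡ z l) → (1 ≤ k → u k ≡ z k + t k * c k) →
              (∀ l → 1 ≤ l → l < k → u l + t (suc l) * b l ≡ z l + t l * c l) → u ⇝ z
      sweep zero    u _   settled _       _       = ⇝-≐ʳ u ε settled
      sweep (suc i) u k≤d settled current pending =
        cascades (t k) u i k≤d room upper ◅◅ sweep i swept (<⇒≤ k≤d) settled′ current′ pending′
        where
          k = suc i
          swept = cascade (t k) u k

          room : deg k + t k * c k ≤ u k + c k
          room = subst (deg k + t k * c k ≤_)
            (trans (xy∙z≈xz∙y (z k) (c k) (t k * c k)) (cong (_+ c k) (sym (current (s≤s z≤n)))))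
            (+-monoˡ-≤ (t k * c k) (critical k (s≤s z≤n) k≤d))

          upper : ∀ l → k < l → l ≤ d → deg l ≤ u l + c l
          upper l k<l l≤d = subst (λ x → deg l ≤ x + c l) (sym (settled l k<l l≤d))
                                  (critical l (≤-trans (s≤s z≤n) k<l) l≤d)

          settled′ : ∀ l → i < l → l ≤ d → swept l ≡ z l
          settled′ l i<l l≤d with m≤n⇒m<n∨m≡n i<l
          ... | inj₂ refl = trans (cascade-at (t k) u k)
                                  (trans (cong (_∸ t k * c k) (current (s≤s z≤n))) (m+n∸n≡m (z k) (t k * c k)))
          ... | inj₁ k<l  = trans (cascade-beyond (t k) u k l k<l) (settled l k<l l≤d)

          current′ : 1 ≤ i → swept i ≡ z i + t i * c i
          current′ 1≤i = trans (cascade-below (t k) u i) (pending i 1≤i (n<1+n i))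

          pending′ : ∀ l → 1 ≤ l → l < i → swept l + t (suc l) * b l ≡ z l + t l * c l
          pending′ l 1≤l l<i = trans (cong (_+ t (suc l) * b l) (cascade-beneath (t k) u k l (s≤s l<i)))
                                     (pending l 1≤l (<-trans l<i (n<1+n i)))

  maxStable : ℕ → ℕ
  maxStable k = deg k ∸ 1

  1+maxStable≡deg : ∀ k → 1 ≤ k → k ≤ d → suc (maxStable k) ≡ deg k
  1+maxStable≡deg k 1≤k k≤d = trans (+-comm 1 (maxStable k)) (m∸n+n≡m (≤-trans (c-pos k 1≤k k≤d) (c≤deg k)))

  stable-cfg : ∀ u → (∀ k → 1 ≤ k → k ≤ d → u k < deg k) → Stable E (cfg u)
  stable-cfg u u<deg j = subst₂ _<_ (sym (lookup-cfg u j)) (sym (outdeg-nonsink j))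
                           (u<deg _ (dist-nonsink j) (d-bound (suc j)))

  maxStable-stable : Stable E (cfg maxStable)
  maxStable-stable = stable-cfg maxStable λ k 1≤k k≤d → ≤-reflexive (1+maxStable≡deg k 1≤k k≤d)

  ≤-maxStable : ∀ {x} → Stable E x → ∀ j → lookup x j ≤ lookup (cfg maxStable) j
  ≤-maxStable {x} x-stable j = subst (lookup x j ≤_) (sym (lookup-cfg maxStable j))
    (∸-monoˡ-≤ 1 (subst (lookup x j <_) (outdeg-nonsink j) (x-stable j)))

  cfg-+ : ∀ u v → cfg (λ k → u k + v k) ≡ cfg u +ᶜ cfg v
  cfg-+ u v = vec-ext λ j → trans (lookup-cfg (λ k → u k + v k) j)
    (sym (trans (lookup-+ᶜ (cfg u) (cfg v) j) (cong₂ _+_ (lookup-cfg u j) (lookup-cfg v j))))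

  ns e : ℕ → ℕ
  ns = nSeq d a b c
  e = eCoef d a b c

  ns-step : ∀ k → k ≤ d → ns k ≡ (maxStable k + ns (suc k) * b k) div c k
  ns-step k k≤d = begin
    ns k                                       ≡⟨ nSeq-downward d a b c k ⟩
    downward d (nStep a b c) k                 ≡⟨ downward-step d (nStep a b c) k k≤d ⟩
    nStep a b c k (downward d (nStep a b c) (suc k)) ≡⟨ cong (nStep a b c k) (nSeq-downward d a b c (suc k)) ⟨
    nStep a b c k (ns (suc k))                 ∎

  e-window : ∀ k → 1 ≤ k → k ≤ d →
    e k + ns (suc k) * b k ≡ ns k * c k × e k ≤ maxStable k × deg k ≤ e k + c k
  e-window k 1≤k k≤d =
    m∸n+n≡m B≤P ,
    P∸B≤M ,
    subst (_≤ e k + c k) (1+maxStable≡deg k 1≤k k≤d) 1+M≤P∸B+C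
    where
      N = maxStable k + ns (suc k) * b k
      P≡ : ns k * c k ≡ N div c k * c k
      P≡ = cong (_* c k) (ns-step k k≤d)
      window = remainder-window (maxStable k) (ns (suc k) * b k) (ns k * c k) (c k)
        (subst (c k ≤_) (sym (1+maxStable≡deg k 1≤k k≤d)) (c≤deg k))
        (subst (_≤ N) (sym P≡) (proj₁ (div-floor N (c k) (c-pos k 1≤k k≤d))))
        (subst (λ P → N < P + c k) (sym P≡) (proj₂ (div-floor N (c k) (c-pos k 1≤k k≤d))))
      B≤P = proj₁ window
      P∸B≤M = proj₁ (proj₂ window)
      1+M≤P∸B+C = proj₂ (proj₂ window)

  e+maxStable⇝maxStable : Steps (cfg e +ᶜ cfg maxStable) (cfg maxStable)
  e+maxStable⇝maxStable = subst (λ x → Steps x (cfg maxStable)) (cfg-+ e maxStable)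
    (reach-by-cascades maxStable ns (λ k → e k + maxStable k) critical balanced)
    where
      critical : ∀ k → 1 ≤ k → k ≤ d → deg k ≤ maxStable k + c k
      critical k 1≤k k≤d = subst (_≤ maxStable k + c k) (1+maxStable≡deg k 1≤k k≤d)
        (subst (_≤ maxStable k + c k) (+-comm (maxStable k) 1) (+-monoʳ-≤ (maxStable k) (c-pos k 1≤k k≤d)))
      balanced : ∀ k → 1 ≤ k → k ≤ d → e k + maxStable k + ns (suc k) * b k ≡ maxStable k + ns k * c k
      balanced k 1≤k k≤d = begin
        e k + maxStable k + ns (suc k) * b k   ≡⟨ cong (_+ ns (suc k) * b k) (+-comm (e k) (maxStable k)) ⟩
        maxStable k + e k + ns (suc k) * b k   ≡⟨ +-assoc (maxStable k) (e k) _ ⟩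
        maxStable k + (e k + ns (suc k) * b k) ≡⟨ cong (maxStable k +_) (proj₁ (e-window k 1≤k k≤d)) ⟩
        maxStable k + ns k * c k                ∎

  deficit : ℕ → ℕ → ℕ
  deficit k t = maxStable k ∸ e k + t * b k

  fillCount : ℕ → ℕ
  fillCount = downward d (λ k t → (deficit k t + (c k ∸ 1)) div c k)

  fill : ℕ → ℕ
  fill k = fillCount k * c k ∸ deficit k (fillCount (suc k))

  fill-window : ∀ k → 1 ≤ k → k ≤ d → deficit k (fillCount (suc k)) ≤ fillCount k * c k × fill k < c k
  fill-window k 1≤k k≤d =
    subst (λ q → deficit k (fillCount (suc k)) ≤ q * c k × q * c k ∸ deficit k (fillCount (suc k)) < c k)
      (sym (downward-step d _ k k≤d))
      (div-ceiling (deficit k (fillCount (suc k))) (c k) (c-pos k 1≤k k≤d))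

  fill-stable : Stable E (cfg fill)
  fill-stable = stable-cfg fill λ k 1≤k k≤d → ≤-trans (proj₂ (fill-window k 1≤k k≤d)) (c≤deg k)

  e-stable : Stable E (cfg e)
  e-stable = stable-cfg e λ k 1≤k k≤d →
    subst (e k <_) (1+maxStable≡deg k 1≤k k≤d) (s≤s (proj₁ (proj₂ (e-window k 1≤k k≤d))))

  maxStable+fill⇝e : Steps (cfg maxStable +ᶜ cfg fill) (cfg e)
  maxStable+fill⇝e = subst (λ x → Steps x (cfg e)) (cfg-+ maxStable fill)
    (reach-by-cascades e fillCount (λ k → maxStable k + fill k)
      (λ k 1≤k k≤d → proj₂ (proj₂ (e-window k 1≤k k≤d)))
      (λ k 1≤k k≤d → refill (maxStable k) (e k) (fillCount (suc k) * b k) (fillCount k * c k)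
         (proj₁ (proj₂ (e-window k 1≤k k≤d)))
         (proj₁ (fill-window k 1≤k k≤d))))

theorem6p7 : (n : ℕ) → 1 ≤ n → (E : Mult n) → (dist : Fin (suc n) → ℕ) →
    (d : ℕ) → (a b c : ℕ → ℕ) → SinkDistanceRegular E dist d a b c →
    (G : Config n → Set) → IsMinimalIdeal E G →
    G (eConfig dist d a b c) × (∀ g → G g → Stab E (eConfig dist d a b c +ᶜ g) g)
theorem6p7 n _ E dist d a b c R G G-minimal@(G-ideal@(G-stable , G-closed) , (g , g∈G) , _) =
  e∈G , λ h h∈G → absorbs-one⇒absorbs-all G-minimal max∈G e+maxStable⇝maxStable h h∈G , G-stable h h∈G
  where
    open Layered E dist d a b c R

    max∈G : G (cfg maxStable)
    max∈G = ideal-∋-dominating G-ideal g∈G maxStable-stable (≤-maxStable {g} (G-stable g g∈G))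

    e∈G : G (cfg e)
    e∈G = G-closed _ _ _ max∈G fill-stable (maxStable+fill⇝e , e-stable)
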